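{- If $\mathcal{D}\triangleleft\Gamma\vdash M:\S\sigma$ is a derivation in $\mathsf{LEM}$, then $\Gamma$ is a strictly exponential context, i.e. every type in $\Gamma$ has the form $\S\rho$.
   Context: $\mathsf{LEM}$: linear types $A ::= \alpha \mid \sigma\multimap A \mid \forall\alpha.A$; types $\sigma ::= A \mid \S\sigma$, where in $\S\sigma$ the type $\sigma$ is closed with no negative occurrence of $\forall$. Values are closed $\beta$-normal linear $\lambda$-terms. Terms: $x\mid\lambda x.M\mid MN\mid\mathtt{discard}_\sigma\,M\ \mathtt{in}\ N\mid\mathtt{copy}^V_\sigma\,M\ \mathtt{as}\ x,y\ \mathtt{in}\ N$ ($V$ a value), linear only. Typing rules (contexts of distinct variables, disjoint when juxtaposed): (ax) $x:A\vdash x:A$, $A$ linear; (cut) from $\Gamma\vdash N:\sigma$, $\Delta,x:\sigma\vdash M:\tau$ infer $\Gamma,\Delta\vdash M[N/x]:\tau$; ($\multimap$R) from $\Gamma,x:\sigma\vdash M:B$ infer $\Gamma\vdash\lambda x.M:\sigma\multimap B$; ($\multimap$L) from $\Gamma\vdash N:\sigma$, $\Delta,x:B\vdash M:\tau$ infer $\Gamma,\Delta,y:\sigma\multimap B\vdash M[yN/x]:\tau$; ($\forall$R) from $\Gamma\vdash M:A\langle\gamma/\alpha\rangle$, $\gamma$ not free in $\Gamma$, infer $\Gamma\vdash M:\forall\alpha.A$; ($\forall$L) from $\Gamma,x:A\langle B/\alpha\rangle\vdash M:\tau$ infer $\Gamma,x:\forall\alpha.A\vdash M:\tau$; ($p$)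 from $x_1:\S\sigma_1,\dots,x_n:\S\sigma_n\vdash M:\sigma$ infer the same context $\vdash M:\S\sigma$; ($d$) from $\Gamma,x:\sigma\vdash M:\tau$ infer $\Gamma,y:\S\sigma\vdash M[y/x]:\tau$; ($w$) from $\Gamma\vdash M:\tau$ infer $\Gamma,x:\S\sigma\vdash\mathtt{discard}_\sigma\,x\ \mathtt{in}\ M:\tau$; ($c$) from $\Gamma,y:\S\sigma,z:\S\sigma\vdash M:\tau$ and $\vdash V:\sigma$ infer $\Gamma,x:\S\sigma\vdash\mathtt{copy}^V_\sigma\,x\ \mathtt{as}\ y,z\ \mathtt{in}\ M:\tau$. -}

module Defs where

open import Data.Nat using (ℕ; zero; suc; _≡ᵇ_)
open import Data.Fin using (Fin; zero; suc)
open import Data.Bool using (if_then_else_)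
open import Data.Product using (_×_; _,_; proj₁; proj₂)
open import Data.List using (List; []; _∷_; _++_; map)
open import Data.List.Relation.Unary.All using (All)
open import Data.List.Relation.Unary.Unique.Propositional using (Unique)
open import Data.List.Relation.Binary.Permutation.Propositional using (_↭_)
open import Relation.Nullary using (¬_)

-- Types of LEM (locally nameless: free type variables are names ℕ,
-- bound type variables are de Bruijn indices in Fin n; Ty 0 = types
-- with no dangling bound variable, i.e. the paper's types).

mutual
  data LType (n : ℕ) : Set where
    tvar : ℕ → LType n
    tbv  : Fin n → LType n
    _⊸_  : Ty n → LType n → LType n
    ∀'   : LType (suc n) → LType n

  data Ty (n : ℕ) : Set where
    lin : LType n → Ty n
    -- § σ : σ closed (no bound vars by Ty 0, no free vars by NoFVT)
    --       and without negative occurrences of ∀ (PosT)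
    § : (σ : Ty 0) → NoFVT σ → PosT σ → Ty n

  data NoFVL {n : ℕ} : LType n → Set where
    nf-bv  : ∀ {i} → NoFVL (tbv i)
    nf-⊸   : ∀ {σ A} → NoFVT σ → NoFVL A → NoFVL (σ ⊸ A)
    nf-∀   : ∀ {A} → NoFVL A → NoFVL (∀' A)

  data NoFVT {n : ℕ} : Ty n → Set where
    nf-lin : ∀ {A} → NoFVL A → NoFVT (lin A)
    nf-§   : ∀ {σ c p} → NoFVT (§ {n} σ c p)

  -- PosL/PosT A : A, seen in positive position, has no negative ∀.
  -- NegL/NegT A : A, seen in negative position, has no negative ∀
  -- (i.e. no ∀ occurring at overall-negative polarity).
  data PosL {n : ℕ} : LType n → Set where
    p-var : ∀ {a} → PosL (tvar a)
    p-bv  : ∀ {i} → PosL (tbv i)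
    p-⊸   : ∀ {σ A} → NegT σ → PosL A → PosL (σ ⊸ A)
    p-∀   : ∀ {A} → PosL A → PosL (∀' A)

  data NegL {n : ℕ} : LType n → Set where
    n-var : ∀ {a} → NegL (tvar a)
    n-bv  : ∀ {i} → NegL (tbv i)
    n-⊸   : ∀ {σ A} → PosT σ → NegL A → NegL (σ ⊸ A)

  data PosT {n : ℕ} : Ty n → Set where
    p-lin : ∀ {A} → PosL A → PosT (lin A)
    p-§   : ∀ {σ c p} → PosT σ → PosT (§ {n} σ c p)

  data NegT {n : ℕ} : Ty n → Set where
    n-lin : ∀ {A} → NegL A → NegT (lin A)
    n-§   : ∀ {σ c p} → NegT σ → NegT (§ {n} σ c p)

extR : ∀ {m n} → (Fin m → Fin n) → Fin (suc m) → Fin (suc n)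
extR ρ zero    = zero
extR ρ (suc i) = suc (ρ i)

mutual
  renL : ∀ {m n} → (Fin m → Fin n) → LType m → LType n
  renL ρ (tvar a) = tvar a
  renL ρ (tbv i)  = tbv (ρ i)
  renL ρ (σ ⊸ A)  = renT ρ σ ⊸ renL ρ A
  renL ρ (∀' A)   = ∀' (renL (extR ρ) A)

  renT : ∀ {m n} → (Fin m → Fin n) → Ty m → Ty n
  renT ρ (lin A)     = lin (renL ρ A)
  renT ρ (§ σ c p)   = § σ c p

extS : ∀ {m n} → (Fin m → LType n) → Fin (suc m) → LType (suc n)
extS s zero    = tbv zero
extS s (suc i) = renL suc (s i)

mutual
  subL : ∀ {m n} → (Fin m → LType n) → LType m → LType n
  subL s (tvar a) = tvar a
  subL s (tbv i)  = s i
  subL s (σ ⊸ A)  = subT s σ ⊸ subL s A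
  subL s (∀' A)   = ∀' (subL (extS s) A)

  subT : ∀ {m n} → (Fin m → LType n) → Ty m → Ty n
  subT s (lin A)   = lin (subL s A)
  subT s (§ σ c p) = § σ c p

_⟨_⟩ : LType 1 → LType 0 → LType 0
A ⟨ B ⟩ = subL (λ { zero → B }) A

mutual
  data _∈FVL_ (γ : ℕ) {n : ℕ} : LType n → Set where
    fv-var : γ ∈FVL tvar γ
    fv-⊸₁  : ∀ {σ A} → γ ∈FVT σ → γ ∈FVL (σ ⊸ A)
    fv-⊸₂  : ∀ {σ A} → γ ∈FVL A → γ ∈FVL (σ ⊸ A)
    fv-∀   : ∀ {A} → γ ∈FVL A → γ ∈FVL (∀' A)

  data _∈FVT_ (γ : ℕ) {n : ℕ} : Ty n → Set where
    fv-lin : ∀ {A} → γ ∈FVL A → γ ∈FVT lin A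
    fv-§   : ∀ {σ c p} → γ ∈FVT σ → γ ∈FVT § σ c p

-- Terms (locally nameless: free term variables are names ℕ, bound ones
-- de Bruijn indices).

data Term (n : ℕ) : Set where
  var     : ℕ → Term n
  bvar    : Fin n → Term n
  lam     : Term (suc n) → Term n
  app     : Term n → Term n → Term n
  discard : Ty 0 → Term n → Term n → Term n
  -- copy^V_σ M as x,y in N   (N binds two variables)
  copy    : Ty 0 → Term 0 → Term n → Term (suc (suc n)) → Term n

mutual
  data Ne {n : ℕ} : Term n → Set where
    ne-var  : ∀ {x} → Ne (var x)
    ne-bvar : ∀ {i} → Ne (bvar i)
    ne-app  : ∀ {M N} → Ne M → Nf N → Ne (app M N)

  data Nf {n : ℕ} : Term n → Set where
    nf-ne  : ∀ {M} → Ne M → Nf M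
    nf-lam : ∀ {M} → Nf M → Nf (lam M)

-- A value: a closed (Term 0, and typed in the empty context in rule c)
-- β-normal linear λ-term (linearity is enforced by the typing premise
-- ⊢ V : σ, since pure λ-terms can only be typed linearly).
IsValue : Term 0 → Set
IsValue V = Nf V

renM : ∀ {m n} → (Fin m → Fin n) → Term m → Term n
renM ρ (var x)           = var x
renM ρ (bvar i)          = bvar (ρ i)
renM ρ (lam M)           = lam (renM (extR ρ) M)
renM ρ (app M N)         = app (renM ρ M) (renM ρ N)
renM ρ (discard σ M N)   = discard σ (renM ρ M) (renM ρ N)
renM ρ (copy σ V M N)    = copy σ V (renM ρ M) (renM (extR (extR ρ)) N)

extB : ∀ {m n} → (Fin m → Term n) → Fin (suc m) → Term (suc n)
extB s zero    = bvar zero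
extB s (suc i) = renM suc (s i)

extF : ∀ {n} → (ℕ → Term n) → ℕ → Term (suc n)
extF f y = renM suc (f y)

subM : ∀ {m n} → (Fin m → Term n) → (ℕ → Term n) → Term m → Term n
subM s f (var x)         = f x
subM s f (bvar i)        = s i
subM s f (lam M)         = lam (subM (extB s) (extF f) M)
subM s f (app M N)       = app (subM s f M) (subM s f N)
subM s f (discard σ M N) = discard σ (subM s f M) (subM s f N)
subM s f (copy σ V M N)  =
  copy σ V (subM s f M) (subM (extB (extB s)) (extF (extF f)) N)

_[_/_] : Term 0 → Term 0 → ℕ → Term 0
M [ N / x ] = subM bvar (λ y → if y ≡ᵇ x then N else var y) M

close : ∀ {n} → ℕ → Term n → Term (suc n)
close x = subM (λ i → bvar (suc i)) (λ y → if y ≡ᵇ x then bvar zero else var y)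

ƛ_⇒_ : ℕ → Term 0 → Term 0
ƛ x ⇒ M = lam (close x M)

copyAs : Ty 0 → Term 0 → Term 0 → ℕ → ℕ → Term 0 → Term 0
copyAs σ V M y z N = copy σ V M (close y (close z N))

Ctx : Set
Ctx = List (ℕ × Ty 0)

Distinct : Ctx → Set
Distinct Γ = Unique (map proj₁ Γ)

_,_∶_ : Ctx → ℕ → Ty 0 → Ctx
Γ , x ∶ σ = Γ ++ (x , σ) ∷ []

infixl 5 _,_∶_

data IsExp : Ty 0 → Set where
  isExp : ∀ {ρ c p} → IsExp (§ ρ c p)

StrictlyExp : Ctx → Set
StrictlyExp Γ = All (λ d → IsExp (proj₂ d)) Γ

FreshIn : ℕ → Ctx → Set
FreshIn γ Γ = All (λ d → ¬ (γ ∈FVT proj₂ d)) Γ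

infix 3 _⊢_∶_

data _⊢_∶_ : Ctx → Term 0 → Ty 0 → Set where
  exch : ∀ {Γ Δ M τ} → Γ ↭ Δ → Γ ⊢ M ∶ τ → Δ ⊢ M ∶ τ
  ax   : ∀ {x A} → [] , x ∶ lin A ⊢ var x ∶ lin A
  cut  : ∀ {Γ Δ x N M σ τ} → Distinct (Γ ++ Δ) →
         Γ ⊢ N ∶ σ → Δ , x ∶ σ ⊢ M ∶ τ →
         Γ ++ Δ ⊢ M [ N / x ] ∶ τ
  ⊸R   : ∀ {Γ x M σ B} →
         Γ , x ∶ σ ⊢ M ∶ lin B → Γ ⊢ ƛ x ⇒ M ∶ lin (σ ⊸ B)
  ⊸L   : ∀ {Γ Δ x y N M σ B τ} → Distinct ((Γ ++ Δ) , y ∶ lin (σ ⊸ B)) →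
         Γ ⊢ N ∶ σ → Δ , x ∶ lin B ⊢ M ∶ τ →
         (Γ ++ Δ) , y ∶ lin (σ ⊸ B) ⊢ M [ app (var y) N / x ] ∶ τ
  ∀R   : ∀ {Γ M A γ} → FreshIn γ Γ → ¬ (γ ∈FVL ∀' A) →
         Γ ⊢ M ∶ lin (A ⟨ tvar γ ⟩) → Γ ⊢ M ∶ lin (∀' A)
  ∀L   : ∀ {Γ x M A B τ} →
         Γ , x ∶ lin (A ⟨ B ⟩) ⊢ M ∶ τ → Γ , x ∶ lin (∀' A) ⊢ M ∶ τ
  p    : ∀ {Γ M σ} → (c : NoFVT σ) → (q : PosT σ) → StrictlyExp Γ →
         Γ ⊢ M ∶ σ → Γ ⊢ M ∶ § σ c q
  d    : ∀ {Γ x y M σ τ} → (c : NoFVT σ) → (q : PosT σ) →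
         Distinct (Γ , y ∶ § σ c q) →
         Γ , x ∶ σ ⊢ M ∶ τ → Γ , y ∶ § σ c q ⊢ M [ var y / x ] ∶ τ
  w    : ∀ {Γ x M σ τ} → (c : NoFVT σ) → (q : PosT σ) →
         Distinct (Γ , x ∶ § σ c q) →
         Γ ⊢ M ∶ τ → Γ , x ∶ § σ c q ⊢ discard σ (var x) M ∶ τ
  c    : ∀ {Γ x y z M V σ τ} → (cl : NoFVT σ) → (q : PosT σ) →
         Distinct (Γ , x ∶ § σ cl q) → IsValue V →
         Γ , y ∶ § σ cl q , z ∶ § σ cl q ⊢ M ∶ τ → [] ⊢ V ∶ σ →
         Γ , x ∶ § σ cl q ⊢ copyAs σ V (var x) y z M ∶ τ

module Submission where

-- Induction on the derivation, proving the claim for every exponential conclusion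
-- (the cut case needs it for the cut formula, which the right premise forces to be
-- exponential). Promotion requires the invariant as a premise, d/w/c only add § σ to
-- the context, and ⊸L, ∀L cannot end such a derivation: by induction their
-- premise's context would contain a linear formula.

open import Defs
open import Data.List.Relation.Unary.All using ([]; _∷_)
open import Data.List.Relation.Unary.All.Properties using (++⁺; ++⁻ˡ; ++⁻ʳ)
open import Data.List.Relation.Binary.Permutation.Propositional.Properties using (All-resp-↭)
open import Relation.Nullary using (¬_)

StrictlyExp-init : ∀ Γ {x σ} → StrictlyExp (Γ , x ∶ σ) → StrictlyExp Γ
StrictlyExp-init Γ = ++⁻ˡ Γ

StrictlyExp-last : ∀ Γ {x σ} → StrictlyExp (Γ , x ∶ σ) → IsExp σ
StrictlyExp-last Γ h with ++⁻ʳ Γ h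
... | e ∷ [] = e

StrictlyExp-snoc : ∀ {Γ x σ} → StrictlyExp Γ → IsExp σ → StrictlyExp (Γ , x ∶ σ)
StrictlyExp-snoc h e = ++⁺ h (e ∷ [])

¬IsExp-lin : ∀ {A} → ¬ IsExp (lin A)
¬IsExp-lin ()

exp-conclusion⇒StrictlyExp : ∀ {Γ M τ} → Γ ⊢ M ∶ τ → IsExp τ → StrictlyExp Γ
exp-conclusion⇒StrictlyExp (exch π D) e = All-resp-↭ π (exp-conclusion⇒StrictlyExp D e)
exp-conclusion⇒StrictlyExp ax ()
exp-conclusion⇒StrictlyExp (cut {Δ = Δ} _ D₁ D₂) e =
  ++⁺ (exp-conclusion⇒StrictlyExp D₁ (StrictlyExp-last Δ Δx)) (StrictlyExp-init Δ Δx)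
  where Δx = exp-conclusion⇒StrictlyExp D₂ e
exp-conclusion⇒StrictlyExp (⊸R D) ()
exp-conclusion⇒StrictlyExp (⊸L {Δ = Δ} _ D₁ D₂) e
  with () ← ¬IsExp-lin (StrictlyExp-last Δ (exp-conclusion⇒StrictlyExp D₂ e))
exp-conclusion⇒StrictlyExp (∀R _ _ D) ()
exp-conclusion⇒StrictlyExp (∀L {Γ} D) e
  with () ← ¬IsExp-lin (StrictlyExp-last Γ (exp-conclusion⇒StrictlyExp D e))
exp-conclusion⇒StrictlyExp (p _ _ Γ-exp D) e = Γ-exp
exp-conclusion⇒StrictlyExp (d {Γ} _ _ _ D) e =
  StrictlyExp-snoc (StrictlyExp-init Γ (exp-conclusion⇒StrictlyExp D e)) isExp
exp-conclusion⇒StrictlyExp (w _ _ _ D) e =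
  StrictlyExp-snoc (exp-conclusion⇒StrictlyExp D e) isExp
exp-conclusion⇒StrictlyExp (c {Γ} _ _ _ _ D _) e =
  StrictlyExp-snoc (StrictlyExp-init Γ (StrictlyExp-init (Γ , _ ∶ _) Γyz)) isExp
  where Γyz = exp-conclusion⇒StrictlyExp D e

proposition4p5 : ∀ {Γ M σ} {cl : NoFVT σ} {q : PosT σ} →
    Γ ⊢ M ∶ § σ cl q → StrictlyExp Γ
proposition4p5 D = exp-conclusion⇒StrictlyExp D isExp
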